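{- Let $F:(\mathbf{F}_q^n)^d\to\mathbf{F}_q$ be multi-linear and let $G:(\mathbf{F}_q[t]^n)^{d-1}\to\mathbf{F}_q[t]^n$ be the multi-linear map $G(x)_i=F_{\mathbf{F}_q(t)}(x,e_i)$, where $F_{\mathbf{F}_q(t)}$ is the base change of $F$ and $e_i$ the standard basis vectors. For $R\ge1$ let $N_R(G)=|\{x\in(\mathbf{F}_q[t]^n)^{d-1}:G(x)=0,\ \text{all entries of }x\text{ have degree}<R\}|$. Then for every integer $R>1$, \[ N_R(G)\le|S_F(\mathbf{F}_q)|\cdot N_{R-1}(G), \] where $S_F=\{(x_1,\ldots,x_{d-1}):F(x_1,\ldots,x_{d-1},\cdot)\equiv0\}$. -}

module Defs where

open import Level using (Level; _⊔_)
open import Algebra.Bundles using (CommutativeRing)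
open import Data.Nat using (ℕ; zero; suc)
open import Data.Fin using (Fin; zero; suc; _≟_)
import Data.Fin.Properties as FinP
open import Data.List using (List; []; _∷_; map; concatMap; foldr; length; filter; tabulate; allFin)
open import Data.List.Relation.Unary.All using (All; all?)
open import Data.List.Relation.Unary.Any using (Any)
open import Data.List.Relation.Unary.AllPairs using (AllPairs)
open import Data.Product using (∃; _×_)
open import Relation.Nullary using (¬_; Dec; yes; no)
open import Relation.Unary using (Decidable)
open import Relation.Binary using (DecidableEquality)

allFuns : ∀ {a} {A : Set a} (k : ℕ) → List A → List (Fin k → A)
allFuns zero    xs = (λ ()) ∷ []
allFuns (suc k) xs =
  concatMap (λ a → map (λ f → λ { zero → a ; (suc i) → f i }) (allFuns k xs)) xs

countL : ∀ {a p} {A : Set a} {P : A → Set p} → Decidable P → List A → ℕ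
countL P? xs = length (filter P? xs)

snoc : ∀ {b} {B : Set b} {m : ℕ} → (Fin m → B) → B → Fin (suc m) → B
snoc {m = zero}  x y zero    = y
snoc {m = suc m} x y zero    = x zero
snoc {m = suc m} x y (suc i) = snoc (λ k → x (suc k)) y i

setAt : ∀ {b} {B : Set b} {m : ℕ} → (Fin m → B) → Fin m → B → Fin m → B
setAt x k v k' with k' ≟ k
... | yes _ = v
... | no  _ = x k'

module _ {c ℓ} (K : CommutativeRing c ℓ) where
  open CommutativeRing K

  record IsField : Set (c ⊔ ℓ) where
    field
      0≉1     : ¬ (0# ≈ 1#)
      inverse : ∀ x → ¬ (x ≈ 0#) → ∃ λ y → (x * y) ≈ 1#

  record IsFinite : Set (c ⊔ ℓ) where
    field
      _≟K_     : ∀ x y → Dec (x ≈ y)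
      elems    : List Carrier
      complete : ∀ x → Any (x ≈_) elems
      unique   : AllPairs (λ x y → ¬ (x ≈ y)) elems

  -- A finite field F_q (q = length of the enumeration)
  record IsFiniteField : Set (c ⊔ ℓ) where
    field
      isField  : IsField
      isFinite : IsFinite
    open IsFinite isFinite public

  Vecn : ℕ → Set c
  Vecn n = Fin n → Carrier

  _+ᵥ_ : ∀ {n} → Vecn n → Vecn n → Vecn n
  (u +ᵥ v) l = u l + v l

  _·ᵥ_ : ∀ {n} → Carrier → Vecn n → Vecn n
  (a ·ᵥ u) l = a * u l

  e : ∀ {n} → Fin n → Vecn n
  e i l with i ≟ l
  ... | yes _ = 1#
  ... | no  _ = 0#

  -- F : (K^n)^d → K with d = suc m is multilinear (and respects ≈)
  record IsMultilinear {n m : ℕ} (F : (Fin (suc m) → Vecn n) → Carrier) : Set (c ⊔ ℓ) where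
    field
      cong   : ∀ x x' → (∀ k l → x k l ≈ x' k l) → F x ≈ F x'
      linear : ∀ (x : Fin (suc m) → Vecn n) k a u v →
               F (setAt x k ((a ·ᵥ u) +ᵥ v)) ≈ (a * F (setAt x k u)) + F (setAt x k v)

  -- Polynomials K[t] as coefficient lists (constant term first)

  Poly : Set c
  Poly = List Carrier

  _+P_ : Poly → Poly → Poly
  []       +P q        = q
  (a ∷ p)  +P []       = a ∷ p
  (a ∷ p)  +P (b ∷ q)  = (a + b) ∷ (p +P q)

  _*P_ : Poly → Poly → Poly
  []      *P q = []
  (a ∷ p) *P q = map (a *_) q +P (0# ∷ (p *P q))

  constP : Carrier → Poly
  constP a = a ∷ []

  sumP : List Poly → Poly
  sumP = foldr _+P_ []

  prodP : List Poly → Poly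
  prodP = foldr _*P_ (1# ∷ [])

  IsZeroP : Poly → Set (c ⊔ ℓ)
  IsZeroP p = All (_≈ 0#) p

  -- polynomial of degree < R given by its R coefficients
  PolyLt : ℕ → Set c
  PolyLt R = Fin R → Carrier

  toPoly : ∀ {R} → PolyLt R → Poly
  toPoly {R} f = tabulate f

  -- G(x)_i = F_{K(t)}(x, e_i) for x ∈ (K[t]^n)^m, where the base change of
  -- the multilinear F is given by expanding in the standard basis:
  -- F_{K(t)}(x_1,…,x_m,e_i) = Σ_{j : Fin m → Fin n} F(e_{j 1},…,e_{j m},e_i) Π_k x_k(j k)
  G : ∀ {n m} → (F : (Fin (suc m) → Vecn n) → Carrier) →
      (Fin m → Fin n → Poly) → Fin n → Poly
  G {n} {m} F x i =
    sumP (map (λ j → constP (F (snoc (λ k → e (j k)) (e i)))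
                     *P prodP (map (λ k → x k (j k)) (allFin m)))
              (allFuns m (allFin n)))

  module _ (FF : IsFiniteField) where
    open IsFiniteField FF

    allVecs : (n : ℕ) → List (Vecn n)
    allVecs n = allFuns n elems

    isZeroP? : ∀ p → Dec (IsZeroP p)
    isZeroP? p = all? (λ a → a ≟K 0#) p

    GZero : ∀ {n m} (F : (Fin (suc m) → Vecn n) → Carrier) (R : ℕ) →
            (Fin m → Fin n → PolyLt R) → Set (c ⊔ ℓ)
    GZero {n} F R x = ∀ i → IsZeroP (G F (λ k l → toPoly (x k l)) i)

    GZero? : ∀ {n m} F R → Decidable (GZero {n} {m} F R)
    GZero? {n} F R x = FinP.all? (λ i → isZeroP? (G F (λ k l → toPoly (x k l)) i))

    N : ∀ {n m} (F : (Fin (suc m) → Vecn n) → Carrier) (R : ℕ) → ℕ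
    N {n} {m} F R = countL (GZero? F R) (allFuns m (allFuns n (allFuns R elems)))

    InS : ∀ {n m} (F : (Fin (suc m) → Vecn n) → Carrier) → (Fin m → Vecn n) → Set (c ⊔ ℓ)
    InS {n} F x = All (λ y → F (snoc x y) ≈ 0#) (allVecs n)

    InS? : ∀ {n m} F → Decidable (InS {n} {m} F)
    InS? {n} F x = all? (λ y → F (snoc x y) ≟K 0#) (allVecs n)

    cardS : ∀ {n m} (F : (Fin (suc m) → Vecn n) → Carrier) → ℕ
    cardS {n} {m} F = countL (InS? F) (allFuns m (allVecs n))

{-# OPTIONS --safe #-}
-- Let Z_R be the set of tuples x of polynomials of degree < R with G(x) = 0, and x(0) its
-- tuple of constant terms. The constant term of G(x)_i is F(x(0), e_i), so x(0) ∈ S_F for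
-- x ∈ Z_R. G is linear in each argument separately, so subtracting from row k of x ∈ Z_R
-- a fixed row y with x[k := y] ∈ Z_R and y(0) = x_k(0) keeps x in Z_R and clears the
-- constant term of row k. Doing this for every row gives a map Φ on Z_R which, among tuples
-- with the same constant terms, is injective, and whose values have zero constant terms,
-- i.e. are t·y with y ∈ Z_{R-1} because G(t·y) = t^m G(y). Hence x ↦ (x(0), Φ(x)/t)
-- embeds Z_R into S_F(F_q) × Z_{R-1}.
module Submission where

open import Level using (_⊔_)
open import Function using (id)
open import Data.Empty using (⊥-elim)
open import Data.Nat as ℕ using (ℕ; zero; suc; _≤_; _<_; _∸_; z≤n; s≤s)
import Data.Nat.Properties as ℕₚ
open import Data.Fin as Fin using (Fin; zero; suc)
import Data.Fin.Properties as FinP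
open import Data.Maybe using (just; fromMaybe)
open import Data.Product as Product using (∃; _×_; _,_; proj₁; proj₂)
open import Data.Product.Relation.Binary.Pointwise.NonDependent using (_×ₛ_)
open import Data.Sum using (_⊎_; inj₁; inj₂)
open import Data.List using (List; []; _∷_; _++_; map; foldr; length; filter; concatMap; cartesianProduct; find; allFin)
import Data.List.Properties as List
open import Data.List.Relation.Unary.All as All using (All; []; _∷_)
import Data.List.Relation.Unary.All.Properties as Allₚ
open import Data.List.Relation.Unary.Any as Any using (Any; here; there; _─_)
import Data.List.Relation.Unary.Any.Properties as Anyₚ
open import Data.List.Relation.Unary.AllPairs as AllPairs using (AllPairs; []; _∷_)
import Data.List.Relation.Unary.AllPairs.Properties as AllPairsₚ
import Data.List.Relation.Unary.Unique.Setoid as Unique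
import Data.List.Relation.Unary.Unique.Setoid.Properties as Uniqueₚ
open import Data.List.Relation.Unary.Enumerates.Setoid using (IsEnumeration)
import Data.List.Relation.Binary.Subset.Setoid as Subset
open import Data.List.Membership.Propositional using (_∈_)
open import Data.List.Membership.Propositional.Properties using (∈-allFin)
import Data.List.Membership.Setoid as Membership
import Data.List.Membership.Setoid.Properties as Membershipₚ
open import Data.Vec.Functional using () renaming (_∷_ to _∷ᵥ_)
import Data.Vec.Functional.Relation.Binary.Pointwise.Properties as Pointwise
open import Relation.Nullary using (¬_; Dec; yes; no)
open import Relation.Nullary.Decidable using (_×-dec_)
open import Relation.Unary using (Pred; Decidable; _≐_)
open import Relation.Binary using (Setoid)
open import Relation.Binary.PropositionalEquality as ≡ using (_≡_; _≢_)
import Relation.Binary.Reasoning.Setoid as ≈-Reasoning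
open import Algebra.Bundles using (CommutativeRing)
import Algebra.Properties.CommutativeSemigroup as CommutativeSemigroupₚ
import Algebra.Properties.Ring as Ringₚ

open import Defs hiding (_+ᵥ_; _·ᵥ_)
import Defs

module Lists where

  map-allFin-suc : ∀ {a} {A : Set a} {k} (f : Fin (suc k) → A) →
                   map f (allFin (suc k)) ≡ f zero ∷ map (λ i → f (suc i)) (allFin k)
  map-allFin-suc f =
    ≡.cong (f zero ∷_) (≡.trans (List.map-tabulate suc f) (≡.sym (List.map-tabulate id (λ i → f (suc i)))))

  module _ {a} {A : Set a} where

    ─-preserves-Any : ∀ {p q} {P : Pred A p} {Q : Pred A q} {ys} (i : Any P ys) →
                      Any Q ys → ¬ Q (Any.lookup i) → Any Q (ys ─ i)
    ─-preserves-Any (here _)  (here qy)  ¬q = ⊥-elim (¬q qy)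
    ─-preserves-Any (here _)  (there qs) ¬q = qs
    ─-preserves-Any (there i) (here qy)  ¬q = here qy
    ─-preserves-Any (there i) (there qs) ¬q = there (─-preserves-Any i qs ¬q)

    find-just : ∀ {p} {P : Pred A p} (P? : Decidable P) {xs} → Any P xs →
                ∃ λ x → find P? xs ≡ just x × P x
    find-just P? {x ∷ xs} pxs with P? x | pxs
    ... | yes px | _         = x , ≡.refl , px
    ... | no ¬px | here px   = ⊥-elim (¬px px)
    ... | no ¬px | there pxs = find-just P? pxs

    find-≐ : ∀ {p q} {P : Pred A p} {Q : Pred A q} (P? : Decidable P) (Q? : Decidable Q) →
             P ≐ Q → ∀ xs → find P? xs ≡ find Q? xs
    find-≐ P? Q? P≐Q []       = ≡.refl
    find-≐ P? Q? P≐Q (x ∷ xs) with P? x | Q? x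
    ... | yes _  | yes _  = ≡.refl
    ... | yes px | no ¬qx = ⊥-elim (¬qx (proj₁ P≐Q px))
    ... | no ¬px | yes qx = ⊥-elim (¬px (proj₂ P≐Q qx))
    ... | no _   | no _   = find-≐ P? Q? P≐Q xs

  length-cartesianProduct : ∀ {a b} {A : Set a} {B : Set b} (xs : List A) (ys : List B) →
                            length (cartesianProduct xs ys) ≡ length xs ℕ.* length ys
  length-cartesianProduct []       ys = ≡.refl
  length-cartesianProduct (x ∷ xs) ys = begin
    length (map (x ,_) ys ++ cartesianProduct xs ys)
      ≡⟨ List.length-++ (map (x ,_) ys) ⟩
    length (map (x ,_) ys) ℕ.+ length (cartesianProduct xs ys)
      ≡⟨ ≡.cong₂ ℕ._+_ (List.length-map (x ,_) ys) (length-cartesianProduct xs ys) ⟩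
    length ys ℕ.+ length xs ℕ.* length ys ∎
    where open ≡.≡-Reasoning

module Counting where

  open Lists

  module _ {b ℓ} (S : Setoid b ℓ) where
    open Setoid S
    open Membership S using () renaming (_∈_ to _∈ₛ_)
    open Subset S using (_⊆_)

    unique-⊆⇒length≤ : ∀ {xs ys} → Unique.Unique S xs → xs ⊆ ys → length xs ≤ length ys
    unique-⊆⇒length≤ {[]}     _            _     = z≤n
    unique-⊆⇒length≤ {x ∷ xs} {ys} (x≉xs ∷ xs!) xs⊆ys = begin
      suc (length xs)          ≤⟨ s≤s (unique-⊆⇒length≤ xs! xs⊆ys─x) ⟩
      suc (length (ys ─ x∈ys)) ≡⟨ ≡.sym (List.length-removeAt′ ys (Any.index x∈ys)) ⟩
      length ys                ∎
      where
      open ℕₚ.≤-Reasoning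
      x∈ys : x ∈ₛ ys
      x∈ys = xs⊆ys (here refl)
      xs⊆ys─x : xs ⊆ (ys ─ x∈ys)
      xs⊆ys─x y∈xs = ─-preserves-Any x∈ys (xs⊆ys (there y∈xs)) λ y≈x′ →
        let x≉w , y≈w = All.lookupAny x≉xs y∈xs
        in x≉w (trans (Anyₚ.lookup-result x∈ys) (trans (sym y≈x′) y≈w))

  module _ {a b ℓa ℓb} (SA : Setoid a ℓa) (SB : Setoid b ℓb) where
    open Setoid SA using () renaming (Carrier to A; _≈_ to _≈A_)
    open Setoid SB using () renaming (Carrier to B; _≈_ to _≈B_; sym to symB)
    open Membership SB using () renaming (_∈_ to _∈B_)

    countL-≤-injection : ∀ {p} {P : Pred A p} (P? : Decidable P) (f : A → B) {xs ws} →
      Unique.Unique SA xs → (∀ {x y} → P x → P y → f x ≈B f y → x ≈A y) → (∀ {x} → P x → f x ∈B ws) →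
      countL P? xs ≤ length ws
    countL-≤-injection {P = P} P? f {xs} {ws} xs! inj into = begin
      length (filter P? xs)          ≡⟨ List.length-map f (filter P? xs) ⟨
      length (map f (filter P? xs)) ≤⟨ unique-⊆⇒length≤ SB image-unique image⊆ws ⟩
      length ws                     ∎
      where
      open ℕₚ.≤-Reasoning
      images-distinct : ∀ {ys} → All P ys → Unique.Unique SA ys → AllPairs (λ x y → ¬ f x ≈B f y) ys
      images-distinct []         []          = []
      images-distinct (px ∷ pys) (x≉ys ∷ ys!) =
        All.zipWith (λ (py , x≉y) fx≈fy → x≉y (inj px py fx≈fy)) (pys , x≉ys) ∷ images-distinct pys ys!
      image-unique : Unique.Unique SB (map f (filter P? xs))
      image-unique = AllPairsₚ.map⁺ (images-distinct (Allₚ.all-filter P? xs) (AllPairsₚ.filter⁺ P? xs!))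
      image⊆ws : Subset._⊆_ SB (map f (filter P? xs)) ws
      image⊆ws z∈ = let pw , z≈fw = All.lookupAny (Allₚ.all-filter P? xs) (Anyₚ.map⁻ z∈)
                    in Membershipₚ.∈-resp-≈ SB (symB z≈fw) (into pw)

module Enumeration {a ℓ} (S : Setoid a ℓ) where

  open Setoid S

  Funs : ℕ → Setoid a ℓ
  Funs = Pointwise.setoid S

  allFuns-isEnumeration : ∀ {xs} → IsEnumeration S xs → ∀ k → IsEnumeration (Funs k) (allFuns k xs)
  allFuns-isEnumeration enum zero    f = here (λ ())
  allFuns-isEnumeration enum (suc k) f =
    Anyₚ.concatMap⁺ _ (Any.map (λ f₀≈x → Anyₚ.map⁺ (Any.map (λ f′≈g → λ { zero → f₀≈x ; (suc i) → f′≈g i })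
                                                           (allFuns-isEnumeration enum k (λ i → f (suc i)))))
                             (enum (f zero)))

  allFuns-unique : ∀ {xs} → Unique.Unique S xs → ∀ k → Unique.Unique (Funs k) (allFuns k xs)
  allFuns-unique xs! zero    = [] ∷ []
  allFuns-unique {xs} xs! (suc k) =
    Uniqueₚ.concat⁺ (Funs (suc k))
      (Allₚ.map⁺ (All.universal (λ x → Uniqueₚ.map⁺ (Funs k) (Funs (suc k)) (λ eq i → eq (suc i))
                                                     (allFuns-unique xs! k)) xs))
      (AllPairsₚ.map⁺ (AllPairs.map (λ x≉y {v} (v∈x , v∈y) → x≉y (trans (sym (proj₂ (head v∈x))) (proj₂ (head v∈y))))
                                    xs!))
    where
    head : ∀ {h : (Fin k → Carrier) → Fin (suc k) → Carrier} {gs v} →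
           Membership._∈_ (Funs (suc k)) v (map h gs) → ∃ λ g → v zero ≈ h g zero
    head v∈ = Product.map₂ (λ v≋hg → v≋hg zero) (Any.satisfied (Anyₚ.map⁻ v∈))

module Tuples {b} {B : Set b} where

  setAt-same : ∀ {m} (x : Fin m → B) i v → setAt x i v i ≡ v
  setAt-same x i v with i Fin.≟ i
  ... | yes _  = ≡.refl
  ... | no i≢i = ⊥-elim (i≢i ≡.refl)

  setAt-other : ∀ {m} (x : Fin m → B) i v {j} → j ≢ i → setAt x i v j ≡ x j
  setAt-other x i v {j} j≢i with j Fin.≟ i
  ... | yes j≡i = ⊥-elim (j≢i j≡i)
  ... | no _    = ≡.refl

  setAt-id : ∀ {m} (x : Fin m → B) i j → setAt x i (x i) j ≡ x j
  setAt-id x i j with j Fin.≟ i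
  ... | yes ≡.refl = ≡.refl
  ... | no _       = ≡.refl

  setAt-suc : ∀ {m} (x : Fin (suc m) → B) i v j → setAt x (suc i) v (suc j) ≡ setAt (λ k → x (suc k)) i v j
  setAt-suc x i v j with j Fin.≟ i
  ... | yes _ = ≡.refl
  ... | no _  = ≡.refl

  setAt-∘ : ∀ {c} {C : Set c} {m} (f : B → C) (x : Fin m → B) i v j →
            f (setAt x i v j) ≡ setAt (λ k → f (x k)) i (f v) j
  setAt-∘ f x i v j with j Fin.≟ i
  ... | yes _ = ≡.refl
  ... | no _  = ≡.refl

  setAt-pointwise : ∀ {r} {R : B → B → Set r} {m} {x x′ : Fin m → B} {v v′} i →
                    (∀ j → j ≢ i → R (x j) (x′ j)) → R v v′ → ∀ j → R (setAt x i v j) (setAt x′ i v′ j)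
  setAt-pointwise i x~x′ v~v′ j with j Fin.≟ i
  ... | yes _   = v~v′
  ... | no j≢i  = x~x′ j j≢i

  setAt-apply : ∀ {a} {A : Set a} {m} (X : Fin m → A → B) (j : Fin m → A) i V k →
                setAt X i V k (j k) ≡ setAt (λ k → X k (j k)) i (V (j i)) k
  setAt-apply X j i V k with k Fin.≟ i
  ... | yes ≡.refl = ≡.refl
  ... | no _       = ≡.refl

  snoc-pointwise : ∀ {r} {R : B → B → Set r} {m} {x x′ : Fin m → B} {y y′} →
                   (∀ j → R (x j) (x′ j)) → R y y′ → ∀ j → R (snoc x y j) (snoc x′ y′ j)
  snoc-pointwise {m = zero}  x~x′ y~y′ zero    = y~y′
  snoc-pointwise {m = suc m} x~x′ y~y′ zero    = x~x′ zero
  snoc-pointwise {R = R} {m = suc m} x~x′ y~y′ (suc j) = snoc-pointwise {R = R} (λ j → x~x′ (suc j)) y~y′ j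

  snoc-setAt : ∀ {m} (x : Fin m → B) y i v j → snoc (setAt x i v) y j ≡ setAt (snoc x y) (Fin.inject₁ i) v j
  snoc-setAt {suc m} x y zero    v zero    = ≡.refl
  snoc-setAt {suc m} x y (suc i) v zero    = ≡.refl
  snoc-setAt {suc m} x y zero    v (suc j) = ≡.refl
  snoc-setAt {suc m} x y (suc i) v (suc j) = begin
    snoc (λ k → setAt x (suc i) v (suc k)) y j ≡⟨ snoc-pointwise {R = _≡_} (setAt-suc x i v) ≡.refl j ⟩
    snoc (setAt (λ k → x (suc k)) i v) y j     ≡⟨ snoc-setAt (λ k → x (suc k)) y i v j ⟩
    setAt (snoc (λ k → x (suc k)) y) (Fin.inject₁ i) v j ≡⟨ setAt-suc (snoc x y) (Fin.inject₁ i) v j ⟨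
    setAt (snoc x y) (Fin.inject₁ (suc i)) v (suc j) ∎
    where open ≡.≡-Reasoning

  setAt-snoc-last : ∀ {m} (x : Fin m → B) y y′ j → setAt (snoc x y) (Fin.fromℕ m) y′ j ≡ snoc x y′ j
  setAt-snoc-last {zero}  x y y′ zero    = ≡.refl
  setAt-snoc-last {suc m} x y y′ zero    = ≡.refl
  setAt-snoc-last {suc m} x y y′ (suc j) =
    ≡.trans (setAt-suc (snoc x y) (Fin.fromℕ m) y′ j) (setAt-snoc-last (λ k → x (suc k)) y y′ j)

module Sums {c ℓ} (K : CommutativeRing c ℓ) where

  open CommutativeRing K hiding (zero)
  open Lists using (map-allFin-suc)

  ∑ : ∀ {a} {A : Set a} → List A → (A → Carrier) → Carrier
  ∑ xs f = foldr _+_ 0# (map f xs)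

  ∏ : ∀ {a} {A : Set a} → List A → (A → Carrier) → Carrier
  ∏ xs f = foldr _*_ 1# (map f xs)

  infix 5 ∑ ∏
  syntax ∑ xs (λ x → t) = ∑[ x ∈ xs ] t
  syntax ∏ xs (λ x → t) = ∏[ x ∈ xs ] t

  module _ {a} {A : Set a} where

    ∑-cong : ∀ {f g : A → Carrier} → (∀ x → f x ≈ g x) → ∀ xs → ∑ xs f ≈ ∑ xs g
    ∑-cong f≈g []       = refl
    ∑-cong f≈g (x ∷ xs) = +-cong (f≈g x) (∑-cong f≈g xs)

    ∑-zero : ∀ {f : A → Carrier} → (∀ x → f x ≈ 0#) → ∀ xs → ∑ xs f ≈ 0#
    ∑-zero f≈0 []       = refl
    ∑-zero f≈0 (x ∷ xs) = trans (+-cong (f≈0 x) (∑-zero f≈0 xs)) (+-identityʳ 0#)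

    *-distribˡ-∑ : ∀ a (f : A → Carrier) xs → a * ∑ xs f ≈ ∑[ x ∈ xs ] (a * f x)
    *-distribˡ-∑ a f []       = zeroʳ a
    *-distribˡ-∑ a f (x ∷ xs) = trans (distribˡ a (f x) _) (+-cong refl (*-distribˡ-∑ a f xs))

    ∑-++ : ∀ (f : A → Carrier) xs ys → ∑ (xs ++ ys) f ≈ ∑ xs f + ∑ ys f
    ∑-++ f []       ys = sym (+-identityˡ _)
    ∑-++ f (x ∷ xs) ys = trans (+-cong refl (∑-++ f xs ys)) (sym (+-assoc _ _ _))

  ∑-allFin-suc : ∀ {k} (f : Fin (suc k) → Carrier) →
                 ∑[ i ∈ allFin (suc k) ] f i ≡ f zero + (∑[ i ∈ allFin k ] f (suc i))
  ∑-allFin-suc f = ≡.cong (foldr _+_ 0#) (map-allFin-suc f)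

  ∏-allFin-suc : ∀ {k} (f : Fin (suc k) → Carrier) →
                 ∏[ i ∈ allFin (suc k) ] f i ≡ f zero * (∏[ i ∈ allFin k ] f (suc i))
  ∏-allFin-suc f = ≡.cong (foldr _*_ 1#) (map-allFin-suc f)

  module _ {a b} {A : Set a} {B : Set b} where

    ∑-map : ∀ (f : B → Carrier) (g : A → B) xs → ∑ (map g xs) f ≈ ∑[ x ∈ xs ] f (g x)
    ∑-map f g xs = reflexive (≡.cong (foldr _+_ 0#) (≡.sym (List.map-∘ xs)))

    ∑-concatMap : ∀ (f : B → Carrier) (g : A → List B) xs → ∑ (concatMap g xs) f ≈ ∑[ x ∈ xs ] ∑ (g x) f
    ∑-concatMap f g []       = refl
    ∑-concatMap f g (x ∷ xs) = trans (∑-++ f (g x) (concatMap g xs)) (+-cong refl (∑-concatMap f g xs))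

  ∑-allFuns-suc : ∀ {a} {A : Set a} {k} (xs : List A) (f : (Fin (suc k) → A) → Carrier) →
                  (∀ {g h} → (∀ i → g i ≡ h i) → f g ≈ f h) →
                  ∑[ g ∈ allFuns (suc k) xs ] f g ≈ ∑[ x ∈ xs ] ∑[ g ∈ allFuns k xs ] f (x ∷ᵥ g)
  ∑-allFuns-suc {k = k} xs f f-cong = trans (∑-concatMap f _ xs) (∑-cong (λ x →
    trans (∑-map f _ (allFuns k xs)) (∑-cong (λ g → f-cong (λ { zero → ≡.refl ; (suc i) → ≡.refl })) (allFuns k xs))) xs)

module Polynomials {c ℓ} (K : CommutativeRing c ℓ) where

  open CommutativeRing K hiding (zero)
  open Lists using (map-allFin-suc)
  open Sums K

  infixl 6 _⊕_
  infixl 7 _⊗_ _·ₚ_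
  infix  4 _≈ₚ_

  _⊕_ : Poly K → Poly K → Poly K
  _⊕_ = _+P_ K

  _⊗_ : Poly K → Poly K → Poly K
  _⊗_ = _*P_ K

  _·ₚ_ : Carrier → Poly K → Poly K
  a ·ₚ p = map (a *_) p

  shift : Poly K → Poly K
  shift p = 0# ∷ p

  shift^ : ℕ → Poly K → Poly K
  shift^ zero    p = p
  shift^ (suc k) p = shift (shift^ k p)

  coef : Poly K → ℕ → Carrier
  coef []      s       = 0#
  coef (a ∷ p) zero    = a
  coef (a ∷ p) (suc s) = coef p s

  -- Equality of the polynomials represented, so trailing zero coefficients do not matter.
  record _≈ₚ_ (p q : Poly K) : Set ℓ where
    constructor coefwise
    field coef-≈ : ∀ s → coef p s ≈ coef q s
  open _≈ₚ_ public

  ≈ₚ-setoid : Setoid c ℓ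
  ≈ₚ-setoid = record
    { Carrier       = Poly K
    ; _≈_           = _≈ₚ_
    ; isEquivalence = record
      { refl  = coefwise λ s → refl
      ; sym   = λ p≈q → coefwise λ s → sym (coef-≈ p≈q s)
      ; trans = λ p≈q q≈r → coefwise λ s → trans (coef-≈ p≈q s) (coef-≈ q≈r s)
      }
    }

  open Setoid ≈ₚ-setoid public
    using () renaming (refl to ≈ₚ-refl; sym to ≈ₚ-sym; trans to ≈ₚ-trans; reflexive to ≈ₚ-reflexive)

  coef-⊕ : ∀ p q s → coef (p ⊕ q) s ≈ coef p s + coef q s
  coef-⊕ []      q       s       = sym (+-identityˡ _)
  coef-⊕ (a ∷ p) []      s       = sym (+-identityʳ _)
  coef-⊕ (a ∷ p) (b ∷ q) zero    = refl
  coef-⊕ (a ∷ p) (b ∷ q) (suc s) = coef-⊕ p q s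

  coef-·ₚ : ∀ a p s → coef (a ·ₚ p) s ≈ a * coef p s
  coef-·ₚ a []      s       = sym (zeroʳ a)
  coef-·ₚ a (b ∷ p) zero    = refl
  coef-·ₚ a (b ∷ p) (suc s) = coef-·ₚ a p s

  ⊕-cong : ∀ {p p′ q q′} → p ≈ₚ p′ → q ≈ₚ q′ → p ⊕ q ≈ₚ p′ ⊕ q′
  ⊕-cong {p} {p′} {q} {q′} p≈p′ q≈q′ = coefwise λ s →
    trans (coef-⊕ p q s) (trans (+-cong (coef-≈ p≈p′ s) (coef-≈ q≈q′ s)) (sym (coef-⊕ p′ q′ s)))

  ⊕-identityʳ : ∀ p → p ⊕ [] ≈ₚ p
  ⊕-identityʳ p = coefwise λ s → trans (coef-⊕ p [] s) (+-identityʳ _)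

  ⊕-interchange : ∀ p q r u → (p ⊕ q) ⊕ (r ⊕ u) ≈ₚ (p ⊕ r) ⊕ (q ⊕ u)
  ⊕-interchange p q r u = coefwise λ s → begin
    coef ((p ⊕ q) ⊕ (r ⊕ u)) s
      ≈⟨ trans (coef-⊕ (p ⊕ q) _ s) (+-cong (coef-⊕ p q s) (coef-⊕ r u s)) ⟩
    (coef p s + coef q s) + (coef r s + coef u s)
      ≈⟨ CommutativeSemigroupₚ.interchange +-commutativeSemigroup _ _ _ _ ⟩
    (coef p s + coef r s) + (coef q s + coef u s)
      ≈⟨ sym (trans (coef-⊕ (p ⊕ r) _ s) (+-cong (coef-⊕ p r s) (coef-⊕ q u s))) ⟩
    coef ((p ⊕ r) ⊕ (q ⊕ u)) s ∎
    where open ≈-Reasoning setoid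

  ·ₚ-cong : ∀ {a b p q} → a ≈ b → p ≈ₚ q → a ·ₚ p ≈ₚ b ·ₚ q
  ·ₚ-cong {a} {b} {p} {q} a≈b p≈q = coefwise λ s →
    trans (coef-·ₚ a p s) (trans (*-cong a≈b (coef-≈ p≈q s)) (sym (coef-·ₚ b q s)))

  ·ₚ-zero : ∀ {a} p → a ≈ 0# → a ·ₚ p ≈ₚ []
  ·ₚ-zero {a} p a≈0 = coefwise λ s → trans (coef-·ₚ a p s) (trans (*-cong a≈0 refl) (zeroˡ _))

  ·ₚ-distribˡ : ∀ a p q → a ·ₚ (p ⊕ q) ≈ₚ a ·ₚ p ⊕ a ·ₚ q
  ·ₚ-distribˡ a p q = coefwise λ s → begin
    coef (a ·ₚ (p ⊕ q)) s
      ≈⟨ trans (coef-·ₚ a (p ⊕ q) s) (*-cong refl (coef-⊕ p q s)) ⟩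
    a * (coef p s + coef q s)
      ≈⟨ distribˡ a _ _ ⟩
    a * coef p s + a * coef q s
      ≈⟨ sym (trans (coef-⊕ (a ·ₚ p) _ s) (+-cong (coef-·ₚ a p s) (coef-·ₚ a q s))) ⟩
    coef (a ·ₚ p ⊕ a ·ₚ q) s ∎
    where open ≈-Reasoning setoid

  ·ₚ-distribʳ : ∀ a b p → (a + b) ·ₚ p ≈ₚ a ·ₚ p ⊕ b ·ₚ p
  ·ₚ-distribʳ a b p = coefwise λ s → begin
    coef ((a + b) ·ₚ p) s
      ≈⟨ coef-·ₚ (a + b) p s ⟩
    (a + b) * coef p s
      ≈⟨ distribʳ _ a b ⟩
    a * coef p s + b * coef p s
      ≈⟨ sym (trans (coef-⊕ (a ·ₚ p) _ s) (+-cong (coef-·ₚ a p s) (coef-·ₚ b p s))) ⟩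
    coef (a ·ₚ p ⊕ b ·ₚ p) s ∎
    where open ≈-Reasoning setoid

  shift-cong : ∀ {p q} → p ≈ₚ q → shift p ≈ₚ shift q
  shift-cong p≈q = coefwise λ { zero → refl ; (suc s) → coef-≈ p≈q s }

  shift-[] : shift [] ≈ₚ []
  shift-[] = coefwise λ { zero → refl ; (suc s) → refl }

  shift-⊕ : ∀ p q → shift (p ⊕ q) ≈ₚ shift p ⊕ shift q
  shift-⊕ p q = coefwise λ { zero → sym (+-identityʳ 0#) ; (suc s) → refl }

  shift^-[] : ∀ k → shift^ k [] ≈ₚ []
  shift^-[] zero    = ≈ₚ-refl
  shift^-[] (suc k) = ≈ₚ-trans (shift-cong (shift^-[] k)) shift-[]

  shift^-⊕ : ∀ k p q → shift^ k (p ⊕ q) ≈ₚ shift^ k p ⊕ shift^ k q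
  shift^-⊕ zero    p q = ≈ₚ-refl
  shift^-⊕ (suc k) p q = ≈ₚ-trans (shift-cong (shift^-⊕ k p q)) (shift-⊕ (shift^ k p) (shift^ k q))

  ·ₚ-shift : ∀ a p → a ·ₚ shift p ≈ₚ shift (a ·ₚ p)
  ·ₚ-shift a p = coefwise λ { zero → zeroʳ a ; (suc s) → refl }

  module _ where
    open ≈-Reasoning ≈ₚ-setoid

    ⊗-congʳ : ∀ p {q q′} → q ≈ₚ q′ → p ⊗ q ≈ₚ p ⊗ q′
    ⊗-congʳ []      q≈q′ = ≈ₚ-refl
    ⊗-congʳ (a ∷ p) q≈q′ = ⊕-cong (·ₚ-cong refl q≈q′) (shift-cong (⊗-congʳ p q≈q′))

    ⊗-zeroˡ : ∀ {p} q → p ≈ₚ [] → p ⊗ q ≈ₚ []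
    ⊗-zeroˡ {[]}    q p≈0 = ≈ₚ-refl
    ⊗-zeroˡ {a ∷ p} q p≈0 = begin
      a ·ₚ q ⊕ shift (p ⊗ q)
        ≈⟨ ⊕-cong (·ₚ-zero q (coef-≈ p≈0 zero)) (shift-cong (⊗-zeroˡ {p} q (coefwise λ s → coef-≈ p≈0 (suc s)))) ⟩
      shift []
        ≈⟨ shift-[] ⟩
      [] ∎

    ⊗-congˡ : ∀ {p p′} q → p ≈ₚ p′ → p ⊗ q ≈ₚ p′ ⊗ q
    ⊗-congˡ {[]}    {p′}     q p≈p′ = ≈ₚ-sym (⊗-zeroˡ {p′} q (≈ₚ-sym p≈p′))
    ⊗-congˡ {a ∷ p} {[]}     q p≈p′ = ⊗-zeroˡ q p≈p′
    ⊗-congˡ {a ∷ p} {b ∷ p′} q p≈p′ =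
      ⊕-cong (·ₚ-cong (coef-≈ p≈p′ zero) ≈ₚ-refl) (shift-cong (⊗-congˡ {p} {p′} q (coefwise λ s → coef-≈ p≈p′ (suc s))))

    ⊗-cong : ∀ {p p′ q q′} → p ≈ₚ p′ → q ≈ₚ q′ → p ⊗ q ≈ₚ p′ ⊗ q′
    ⊗-cong {p} {p′} {q} {q′} p≈p′ q≈q′ = ≈ₚ-trans (⊗-congʳ p q≈q′) (⊗-congˡ {p} {p′} q′ p≈p′)

    ⊗-distribˡ : ∀ p q r → p ⊗ (q ⊕ r) ≈ₚ p ⊗ q ⊕ p ⊗ r
    ⊗-distribˡ []      q r = ≈ₚ-refl
    ⊗-distribˡ (a ∷ p) q r = begin
      a ·ₚ (q ⊕ r) ⊕ shift (p ⊗ (q ⊕ r))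
        ≈⟨ ⊕-cong (·ₚ-distribˡ a q r) (shift-cong (⊗-distribˡ p q r)) ⟩
      (a ·ₚ q ⊕ a ·ₚ r) ⊕ shift (p ⊗ q ⊕ p ⊗ r)
        ≈⟨ ⊕-cong ≈ₚ-refl (shift-⊕ (p ⊗ q) (p ⊗ r)) ⟩
      (a ·ₚ q ⊕ a ·ₚ r) ⊕ (shift (p ⊗ q) ⊕ shift (p ⊗ r))
        ≈⟨ ⊕-interchange (a ·ₚ q) (a ·ₚ r) (shift (p ⊗ q)) (shift (p ⊗ r)) ⟩
      (a ∷ p) ⊗ q ⊕ (a ∷ p) ⊗ r ∎

    ⊗-distribʳ : ∀ p q r → (p ⊕ q) ⊗ r ≈ₚ p ⊗ r ⊕ q ⊗ r
    ⊗-distribʳ []      q       r = ≈ₚ-refl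
    ⊗-distribʳ (a ∷ p) []      r = ≈ₚ-sym (⊕-identityʳ ((a ∷ p) ⊗ r))
    ⊗-distribʳ (a ∷ p) (b ∷ q) r = begin
      (a + b) ·ₚ r ⊕ shift ((p ⊕ q) ⊗ r)
        ≈⟨ ⊕-cong (·ₚ-distribʳ a b r) (shift-cong (⊗-distribʳ p q r)) ⟩
      (a ·ₚ r ⊕ b ·ₚ r) ⊕ shift (p ⊗ r ⊕ q ⊗ r)
        ≈⟨ ⊕-cong ≈ₚ-refl (shift-⊕ (p ⊗ r) (q ⊗ r)) ⟩
      (a ·ₚ r ⊕ b ·ₚ r) ⊕ (shift (p ⊗ r) ⊕ shift (q ⊗ r))
        ≈⟨ ⊕-interchange (a ·ₚ r) (b ·ₚ r) (shift (p ⊗ r)) (shift (q ⊗ r)) ⟩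
      (a ∷ p) ⊗ r ⊕ (b ∷ q) ⊗ r ∎

    shift-⊗ : ∀ p q → shift p ⊗ q ≈ₚ shift (p ⊗ q)
    shift-⊗ p q = ⊕-cong (·ₚ-zero q refl) ≈ₚ-refl

    ⊗-shift : ∀ p q → p ⊗ shift q ≈ₚ shift (p ⊗ q)
    ⊗-shift []      q = ≈ₚ-sym shift-[]
    ⊗-shift (a ∷ p) q = begin
      a ·ₚ shift q ⊕ shift (p ⊗ shift q)       ≈⟨ ⊕-cong (·ₚ-shift a q) (shift-cong (⊗-shift p q)) ⟩
      shift (a ·ₚ q) ⊕ shift (shift (p ⊗ q))   ≈⟨ ≈ₚ-sym (shift-⊕ (a ·ₚ q) _) ⟩
      shift ((a ∷ p) ⊗ q)                      ∎

    ⊗-shift^ : ∀ k p q → p ⊗ shift^ k q ≈ₚ shift^ k (p ⊗ q)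
    ⊗-shift^ zero    p q = ≈ₚ-refl
    ⊗-shift^ (suc k) p q = ≈ₚ-trans (⊗-shift p (shift^ k q)) (shift-cong (⊗-shift^ k p q))

  coef-⊗-zero : ∀ p q → coef (p ⊗ q) zero ≈ coef p zero * coef q zero
  coef-⊗-zero []      q = sym (zeroˡ _)
  coef-⊗-zero (a ∷ p) q = trans (coef-⊕ (a ·ₚ q) _ zero) (trans (+-identityʳ _) (coef-·ₚ a q zero))

  module _ {a} {A : Set a} where
    open ≈-Reasoning ≈ₚ-setoid

    ∑ₚ-cong : ∀ {f g : A → Poly K} → (∀ x → f x ≈ₚ g x) → ∀ xs → sumP K (map f xs) ≈ₚ sumP K (map g xs)
    ∑ₚ-cong f≈g []       = ≈ₚ-refl
    ∑ₚ-cong f≈g (x ∷ xs) = ⊕-cong (f≈g x) (∑ₚ-cong f≈g xs)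

    ∑ₚ-⊕ : ∀ (f g : A → Poly K) xs → sumP K (map (λ x → f x ⊕ g x) xs) ≈ₚ sumP K (map f xs) ⊕ sumP K (map g xs)
    ∑ₚ-⊕ f g []       = ≈ₚ-refl
    ∑ₚ-⊕ f g (x ∷ xs) =
      ≈ₚ-trans (⊕-cong ≈ₚ-refl (∑ₚ-⊕ f g xs)) (⊕-interchange (f x) (g x) (sumP K (map f xs)) (sumP K (map g xs)))

    ∑ₚ-shift^ : ∀ k (f : A → Poly K) xs → sumP K (map (λ x → shift^ k (f x)) xs) ≈ₚ shift^ k (sumP K (map f xs))
    ∑ₚ-shift^ k f []       = ≈ₚ-sym (shift^-[] k)
    ∑ₚ-shift^ k f (x ∷ xs) = ≈ₚ-trans (⊕-cong ≈ₚ-refl (∑ₚ-shift^ k f xs)) (≈ₚ-sym (shift^-⊕ k (f x) _))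

    ∏ₚ-cong : ∀ {f g : A → Poly K} → (∀ x → f x ≈ₚ g x) → ∀ xs → prodP K (map f xs) ≈ₚ prodP K (map g xs)
    ∏ₚ-cong f≈g []       = ≈ₚ-refl
    ∏ₚ-cong f≈g (x ∷ xs) = ⊗-cong (f≈g x) (∏ₚ-cong f≈g xs)

    ∏ₚ-shift : ∀ (f : A → Poly K) xs → prodP K (map (λ x → shift (f x)) xs) ≈ₚ shift^ (length xs) (prodP K (map f xs))
    ∏ₚ-shift f []       = ≈ₚ-refl
    ∏ₚ-shift f (x ∷ xs) = begin
      shift (f x) ⊗ prodP K (map (λ x → shift (f x)) xs) ≈⟨ ⊗-congʳ (shift (f x)) (∏ₚ-shift f xs) ⟩
      shift (f x) ⊗ shift^ (length xs) P                 ≈⟨ shift-⊗ (f x) _ ⟩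
      shift (f x ⊗ shift^ (length xs) P)                 ≈⟨ shift-cong (⊗-shift^ (length xs) (f x) P) ⟩
      shift (shift^ (length xs) (f x ⊗ P))               ∎
      where
      P : Poly K
      P = prodP K (map f xs)

    coef-∑ₚ : ∀ (f : A → Poly K) xs s → coef (sumP K (map f xs)) s ≈ ∑[ x ∈ xs ] coef (f x) s
    coef-∑ₚ f []       s = refl
    coef-∑ₚ f (x ∷ xs) s = trans (coef-⊕ (f x) _ s) (+-cong refl (coef-∑ₚ f xs s))

    coef-∏ₚ-zero : ∀ (f : A → Poly K) xs → coef (prodP K (map f xs)) zero ≈ ∏[ x ∈ xs ] coef (f x) zero
    coef-∏ₚ-zero f []       = refl
    coef-∏ₚ-zero f (x ∷ xs) = trans (coef-⊗-zero (f x) _) (*-cong refl (coef-∏ₚ-zero f xs))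

  ∏ₚ-allFin-suc : ∀ {m} (f : Fin (suc m) → Poly K) →
                  prodP K (map f (allFin (suc m))) ≡ f zero ⊗ prodP K (map (λ j → f (suc j)) (allFin m))
  ∏ₚ-allFin-suc f = ≡.cong (prodP K) (map-allFin-suc f)

  ∏ₚ-setAt-⊕ : ∀ {m} (f : Fin m → Poly K) i p q →
               prodP K (map (setAt f i (p ⊕ q)) (allFin m)) ≈ₚ
               prodP K (map (setAt f i p) (allFin m)) ⊕ prodP K (map (setAt f i q) (allFin m))
  ∏ₚ-setAt-⊕ {suc m} f zero p q = begin
    prodP K (map (setAt f zero (p ⊕ q)) (allFin (suc m)))
      ≡⟨ ∏ₚ-allFin-suc (setAt f zero (p ⊕ q)) ⟩
    (p ⊕ q) ⊗ P
      ≈⟨ ⊗-distribʳ p q P ⟩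
    p ⊗ P ⊕ q ⊗ P
      ≡⟨ ≡.sym (≡.cong₂ _⊕_ (∏ₚ-allFin-suc (setAt f zero p)) (∏ₚ-allFin-suc (setAt f zero q))) ⟩
    prodP K (map (setAt f zero p) (allFin (suc m))) ⊕ prodP K (map (setAt f zero q) (allFin (suc m))) ∎
    where
    open ≈-Reasoning ≈ₚ-setoid
    P : Poly K
    P = prodP K (map (λ j → f (suc j)) (allFin m))
  ∏ₚ-setAt-⊕ {suc m} f (suc i) p q = begin
    prodP K (map (setAt f (suc i) (p ⊕ q)) (allFin (suc m)))
      ≡⟨ ∏ₚ-allFin-suc (setAt f (suc i) (p ⊕ q)) ⟩
    f zero ⊗ Tail (p ⊕ q)
      ≡⟨ ≡.cong (f zero ⊗_) (Tail≡Tail′ (p ⊕ q)) ⟩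
    f zero ⊗ Tail′ (p ⊕ q)
      ≈⟨ ⊗-congʳ (f zero) (∏ₚ-setAt-⊕ (λ j → f (suc j)) i p q) ⟩
    f zero ⊗ (Tail′ p ⊕ Tail′ q)
      ≈⟨ ⊗-distribˡ (f zero) (Tail′ p) (Tail′ q) ⟩
    f zero ⊗ Tail′ p ⊕ f zero ⊗ Tail′ q
      ≡⟨ ≡.sym (≡.cong₂ (λ u v → f zero ⊗ u ⊕ f zero ⊗ v) (Tail≡Tail′ p) (Tail≡Tail′ q)) ⟩
    f zero ⊗ Tail p ⊕ f zero ⊗ Tail q
      ≡⟨ ≡.sym (≡.cong₂ _⊕_ (∏ₚ-allFin-suc (setAt f (suc i) p)) (∏ₚ-allFin-suc (setAt f (suc i) q))) ⟩
    prodP K (map (setAt f (suc i) p) (allFin (suc m))) ⊕ prodP K (map (setAt f (suc i) q) (allFin (suc m))) ∎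
    where
    open ≈-Reasoning ≈ₚ-setoid
    Tail Tail′ : Poly K → Poly K
    Tail r  = prodP K (map (λ j → setAt f (suc i) r (suc j)) (allFin m))
    Tail′ r = prodP K (map (setAt (λ j → f (suc j)) i r) (allFin m))
    Tail≡Tail′ : ∀ r → Tail r ≡ Tail′ r
    Tail≡Tail′ r = ≡.cong (prodP K) (List.map-cong (Tuples.setAt-suc f i r) (allFin m))

  IsZeroP⇒≈ₚ[] : ∀ {p} → IsZeroP K p → p ≈ₚ []
  IsZeroP⇒≈ₚ[] []         = ≈ₚ-refl
  IsZeroP⇒≈ₚ[] (a≈0 ∷ p0) = coefwise λ { zero → a≈0 ; (suc s) → coef-≈ (IsZeroP⇒≈ₚ[] p0) s }

  ≈ₚ[]⇒IsZeroP : ∀ {p} → p ≈ₚ [] → IsZeroP K p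
  ≈ₚ[]⇒IsZeroP {[]}    p≈0 = []
  ≈ₚ[]⇒IsZeroP {a ∷ p} p≈0 = coef-≈ p≈0 zero ∷ ≈ₚ[]⇒IsZeroP (coefwise λ s → coef-≈ p≈0 (suc s))

  IsZeroP-shift^ : ∀ k {p} → IsZeroP K (shift^ k p) → IsZeroP K p
  IsZeroP-shift^ zero    p0       = p0
  IsZeroP-shift^ (suc k) (_ ∷ p0) = IsZeroP-shift^ k p0

  toPoly-cong : ∀ {R} {f g : PolyLt K R} → (∀ s → f s ≈ g s) → toPoly K f ≈ₚ toPoly K g
  toPoly-cong {zero}  f≈g = ≈ₚ-refl
  toPoly-cong {suc R} f≈g = coefwise λ { zero → f≈g zero ; (suc s) → coef-≈ (toPoly-cong (λ s → f≈g (suc s))) s }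

  toPoly-+ : ∀ {R} (f g : PolyLt K R) → toPoly K (λ s → f s + g s) ≡ toPoly K f ⊕ toPoly K g
  toPoly-+ {zero}  f g = ≡.refl
  toPoly-+ {suc R} f g = ≡.cong (f zero + g zero ∷_) (toPoly-+ (λ s → f (suc s)) (λ s → g (suc s)))

module MultilinearMaps {c ℓ} (K : CommutativeRing c ℓ) where

  open CommutativeRing K hiding (zero)
  open Sums K
  open Ringₚ ring using (+-cancelˡ)
  open CommutativeSemigroupₚ *-commutativeSemigroup using (x∙yz≈y∙xz)

  infixl 6 _+ᵥ_
  infixl 7 _·ᵥ_

  _+ᵥ_ : ∀ {n} → Vecn K n → Vecn K n → Vecn K n
  _+ᵥ_ = Defs._+ᵥ_ K

  _·ᵥ_ : ∀ {n} → Carrier → Vecn K n → Vecn K n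
  _·ᵥ_ = Defs._·ᵥ_ K

  -- IsMultilinear of Defs, for any number k of arguments (k = 0 included).
  record Multilinear {n k} (H : (Fin k → Vecn K n) → Carrier) : Set (c ⊔ ℓ) where
    field
      cong   : ∀ x x′ → (∀ i l → x i l ≈ x′ i l) → H x ≈ H x′
      linear : ∀ (x : Fin k → Vecn K n) i a u v →
               H (setAt x i (a ·ᵥ u +ᵥ v)) ≈ a * H (setAt x i u) + H (setAt x i v)

  Multilinear-∘ : ∀ {n k k′} {H : (Fin k′ → Vecn K n) → Carrier}
                  (ι : (Fin k → Vecn K n) → Fin k′ → Vecn K n) (κ : Fin k → Fin k′) →
                  (∀ x x′ → (∀ i l → x i l ≈ x′ i l) → ∀ j l → ι x j l ≈ ι x′ j l) →
                  (∀ x i v j → ι (setAt x i v) j ≡ setAt (ι x) (κ i) v j) →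
                  Multilinear H → Multilinear (λ x → H (ι x))
  Multilinear-∘ {H = H} ι κ ι-cong ι-setAt H-ml = record
    { cong   = λ x x′ x≈x′ → cong (ι x) (ι x′) (ι-cong x x′ x≈x′)
    ; linear = λ x i a u v → trans (along x i _) (trans (linear (ι x) (κ i) a u v)
                               (sym (+-cong (*-cong refl (along x i u)) (along x i v))))
    }
    where
    open Multilinear H-ml
    along : ∀ x i v → H (ι (setAt x i v)) ≈ H (setAt (ι x) (κ i) v)
    along x i v = cong _ _ (λ j l → reflexive (≡.cong (λ w → w l) (ι-setAt x i v j)))

  setAt-cong : ∀ {n k} (x : Fin k → Vecn K n) i {u v : Vecn K n} →
               (∀ l → u l ≈ v l) → ∀ j l → setAt x i u j l ≈ setAt x i v j l
  setAt-cong x i {u} {v} =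
    Tuples.setAt-pointwise {R = λ u v → ∀ l → u l ≈ v l} {x = x} {x} {u} {v} i (λ j _ l → refl)

  basis : ∀ {n} (v : Vecn K n) p → ∑[ l ∈ allFin n ] v l * e K l p ≈ v p
  basis {suc n} v p = trans (reflexive (∑-allFin-suc (λ l → v l * e K l p))) (split p)
    where
    e-suc : ∀ {n} (l p : Fin n) → e K (suc l) (suc p) ≡ e K l p
    e-suc l p with l Fin.≟ p
    ... | yes _ = ≡.refl
    ... | no _  = ≡.refl
    split : ∀ p → v zero * e K zero p + (∑[ l ∈ allFin n ] v (suc l) * e K (suc l) p) ≈ v p
    split zero    = trans (+-cong (*-identityʳ _) (∑-zero (λ l → zeroʳ (v (suc l))) (allFin n))) (+-identityʳ _)
    split (suc p) = trans (+-cong (zeroʳ _) (trans (∑-cong (λ l → *-cong refl (reflexive (e-suc l p))) (allFin n))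
                                                   (basis (λ l → v (suc l)) p)))
                          (+-identityˡ _)

  module _ {n k} {H : (Fin k → Vecn K n) → Carrier} (H-ml : Multilinear H) where
    open Multilinear H-ml

    linear-zero : ∀ x i → H (setAt x i (λ _ → 0#)) ≈ 0#
    linear-zero x i = +-cancelˡ h h 0# (begin
      h + h
        ≈⟨ +-cong (*-identityˡ h) refl ⟨
      1# * h + h
        ≈⟨ linear x i 1# _ _ ⟨
      H (setAt x i (1# ·ᵥ (λ _ → 0#) +ᵥ (λ _ → 0#)))
        ≈⟨ cong _ _ (setAt-cong x i (λ l → trans (+-identityʳ _) (zeroʳ 1#))) ⟩
      h
        ≈⟨ +-identityʳ h ⟨
      h + 0# ∎)
      where
      open ≈-Reasoning setoid
      h : Carrier
      h = H (setAt x i (λ _ → 0#))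

    linear-∑ : ∀ x i (v : Vecn K n) ls →
               H (setAt x i (λ p → ∑[ l ∈ ls ] v l * e K l p)) ≈ ∑[ l ∈ ls ] v l * H (setAt x i (e K l))
    linear-∑ x i v []       = linear-zero x i
    linear-∑ x i v (l ∷ ls) = trans (linear x i (v l) (e K l) _) (+-cong refl (linear-∑ x i v ls))

    expand-slot : ∀ x i (v : Vecn K n) → H (setAt x i v) ≈ ∑[ l ∈ allFin n ] v l * H (setAt x i (e K l))
    expand-slot x i v =
      trans (cong _ _ (setAt-cong x i (λ p → sym (basis v p)))) (linear-∑ x i v (allFin n))

  Multilinear-∷ : ∀ {n k} {H : (Fin (suc k) → Vecn K n) → Carrier} → Multilinear H →
                  ∀ w → Multilinear (λ x → H (w ∷ᵥ x))
  Multilinear-∷ H-ml w = Multilinear-∘ (w ∷ᵥ_) suc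
    (λ x x′ x≈x′ → λ { zero l → refl ; (suc j) l → x≈x′ j l })
    (λ { x i v zero → ≡.refl ; x i v (suc j) → ≡.sym (Tuples.setAt-suc (w ∷ᵥ x) i v j) })
    H-ml

  snoc-cong : ∀ {n m} {x x′ : Fin m → Vecn K n} {y y′ : Vecn K n} →
              (∀ k l → x k l ≈ x′ k l) → (∀ l → y l ≈ y′ l) → ∀ j l → snoc x y j l ≈ snoc x′ y′ j l
  snoc-cong {x = x} {x′} {y} {y′} = Tuples.snoc-pointwise {R = λ u v → ∀ l → u l ≈ v l} {x = x} {x′} {y} {y′}

  Multilinear-snoc : ∀ {n m} {H : (Fin (suc m) → Vecn K n) → Carrier} → Multilinear H →
                     ∀ y → Multilinear (λ x → H (snoc x y))
  Multilinear-snoc H-ml y = Multilinear-∘ (λ x → snoc x y) Fin.inject₁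
    (λ x x′ x≈x′ → snoc-cong x≈x′ (λ l → refl))
    (λ x i v j → Tuples.snoc-setAt x y i v j)
    H-ml

  expand : ∀ {n} k {H : (Fin k → Vecn K n) → Carrier} → Multilinear H → ∀ a →
           H a ≈ ∑[ j ∈ allFuns k (allFin n) ] H (λ i → e K (j i)) * (∏[ i ∈ allFin k ] a i (j i))
  expand zero    H-ml a = sym (trans (+-identityʳ _) (trans (*-identityʳ _) (Multilinear.cong H-ml _ _ (λ ()))))
  expand {n} (suc k) {H} H-ml a = begin
    H a
      ≈⟨ cong _ _ (λ i l → reflexive (≡.cong (λ w → w l) (≡.sym (Tuples.setAt-id a zero i)))) ⟩
    H (setAt a zero (a zero))
      ≈⟨ expand-slot H-ml a zero (a zero) ⟩
    ∑[ l ∈ allFin n ] a zero l * H (setAt a zero (e K l))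
      ≈⟨ ∑-cong first-slot (allFin n) ⟩
    ∑[ l ∈ allFin n ] ∑[ g ∈ allFuns k (allFin n) ] term (l ∷ᵥ g)
      ≈⟨ ∑-allFuns-suc (allFin n) term term-cong ⟨
    ∑[ j ∈ allFuns (suc k) (allFin n) ] term j ∎
    where
    open Multilinear H-ml
    open ≈-Reasoning setoid
    term : (Fin (suc k) → Fin n) → Carrier
    term j = H (λ i → e K (j i)) * (∏[ i ∈ allFin (suc k) ] a i (j i))
    term-cong : ∀ {g h} → (∀ i → g i ≡ h i) → term g ≈ term h
    term-cong g≗h = *-cong (cong _ _ (λ i l → reflexive (≡.cong (λ t → e K t l) (g≗h i))))
                           (reflexive (≡.cong (foldr _*_ 1#) (List.map-cong (λ i → ≡.cong (a i) (g≗h i)) (allFin (suc k)))))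
    first-slot : ∀ l → a zero l * H (setAt a zero (e K l)) ≈ ∑[ g ∈ allFuns k (allFin n) ] term (l ∷ᵥ g)
    first-slot l = begin
      a zero l * H (setAt a zero (e K l))
        ≈⟨ *-cong refl (cong _ _ (λ { zero l′ → refl ; (suc i) l′ → refl })) ⟩
      a zero l * H (e K l ∷ᵥ (λ i → a (suc i)))
        ≈⟨ *-cong refl (expand k (Multilinear-∷ H-ml (e K l)) (λ i → a (suc i))) ⟩
      a zero l * (∑[ g ∈ allFuns k (allFin n) ] H (e K l ∷ᵥ (λ i → e K (g i))) * (∏[ i ∈ allFin k ] a (suc i) (g i)))
        ≈⟨ *-distribˡ-∑ (a zero l) _ (allFuns k (allFin n)) ⟩
      ∑[ g ∈ allFuns k (allFin n) ] a zero l * (H (e K l ∷ᵥ (λ i → e K (g i))) * (∏[ i ∈ allFin k ] a (suc i) (g i)))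
        ≈⟨ ∑-cong (λ g → trans (x∙yz≈y∙xz _ _ _) (*-cong (cong _ _ (λ { zero l′ → refl ; (suc i) l′ → refl }))
                                                         (reflexive (≡.sym (∏-allFin-suc (λ i → a i ((l ∷ᵥ g) i)))))))
                  (allFuns k (allFin n)) ⟩
      ∑[ g ∈ allFuns k (allFin n) ] term (l ∷ᵥ g) ∎

  vanishes-on-basis⇒vanishes : ∀ {n m} {H : (Fin (suc m) → Vecn K n) → Carrier} → Multilinear H →
    ∀ (x : Fin m → Vecn K n) → (∀ l → H (snoc x (e K l)) ≈ 0#) → ∀ y → H (snoc x y) ≈ 0#
  vanishes-on-basis⇒vanishes {n} {m} {H} H-ml x H[x,e]≈0 y = begin
    H (snoc x y)
      ≈⟨ along y ⟨
    H (setAt (snoc x y) (Fin.fromℕ m) y)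
      ≈⟨ expand-slot H-ml (snoc x y) (Fin.fromℕ m) y ⟩
    ∑[ l ∈ allFin n ] y l * H (setAt (snoc x y) (Fin.fromℕ m) (e K l))
      ≈⟨ ∑-cong (λ l → *-cong refl (along (e K l))) (allFin n) ⟩
    ∑[ l ∈ allFin n ] y l * H (snoc x (e K l))
      ≈⟨ ∑-zero (λ l → trans (*-cong refl (H[x,e]≈0 l)) (zeroʳ (y l))) (allFin n) ⟩
    0# ∎
    where
    open ≈-Reasoning setoid
    along : ∀ y′ → H (setAt (snoc x y) (Fin.fromℕ m) y′) ≈ H (snoc x y′)
    along y′ = Multilinear.cong H-ml _ _ (λ j l → reflexive (≡.cong (λ w → w l) (Tuples.setAt-snoc-last x y y′ j)))

module BaseChange {c ℓ} (K : CommutativeRing c ℓ) {n m : ℕ}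
                  (F : (Fin (suc m) → Vecn K n) → CommutativeRing.Carrier K) where

  open CommutativeRing K hiding (zero)
  open Sums K
  open Polynomials K
  open MultilinearMaps K

  F-basis : (Fin m → Fin n) → Fin n → Carrier
  F-basis j i = F (snoc (λ k → e K (j k)) (e K i))

  monomial : (Fin m → Fin n → Poly K) → (Fin m → Fin n) → Poly K
  monomial X j = prodP K (map (λ k → X k (j k)) (allFin m))

  G-cong : ∀ {X Y : Fin m → Fin n → Poly K} → (∀ k l → X k l ≈ₚ Y k l) → ∀ i → G K F X i ≈ₚ G K F Y i
  G-cong X≈Y i = ∑ₚ-cong (λ j → ⊗-congʳ (constP K (F-basis j i)) (∏ₚ-cong (λ k → X≈Y k (j k)) (allFin m)))
                         (allFuns m (allFin n))

  monomial-setAt-⊕ : ∀ (X : Fin m → Fin n → Poly K) k (Y W : Fin n → Poly K) j →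
                     monomial (setAt X k (λ l → Y l ⊕ W l)) j ≈ₚ monomial (setAt X k Y) j ⊕ monomial (setAt X k W) j
  monomial-setAt-⊕ X k Y W j = begin
    monomial (setAt X k (λ l → Y l ⊕ W l)) j            ≡⟨ along (λ l → Y l ⊕ W l) ⟩
    P (Y (j k) ⊕ W (j k))                               ≈⟨ ∏ₚ-setAt-⊕ diagonal k (Y (j k)) (W (j k)) ⟩
    P (Y (j k)) ⊕ P (W (j k))                           ≡⟨ ≡.cong₂ _⊕_ (along Y) (along W) ⟨
    monomial (setAt X k Y) j ⊕ monomial (setAt X k W) j ∎
    where
    open ≈-Reasoning ≈ₚ-setoid
    diagonal : Fin m → Poly K
    diagonal k′ = X k′ (j k′)
    P : Poly K → Poly K
    P p = prodP K (map (setAt diagonal k p) (allFin m))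
    along : ∀ V → monomial (setAt X k V) j ≡ P (V (j k))
    along V = ≡.cong (prodP K) (List.map-cong (Tuples.setAt-apply X j k V) (allFin m))

  G-setAt-⊕ : ∀ (X : Fin m → Fin n → Poly K) k (Y W : Fin n → Poly K) i →
              G K F (setAt X k (λ l → Y l ⊕ W l)) i ≈ₚ G K F (setAt X k Y) i ⊕ G K F (setAt X k W) i
  G-setAt-⊕ X k Y W i = ≈ₚ-trans (∑ₚ-cong term (allFuns m (allFin n))) (∑ₚ-⊕ _ _ (allFuns m (allFin n)))
    where
    term : ∀ j → constP K (F-basis j i) ⊗ monomial (setAt X k (λ l → Y l ⊕ W l)) j ≈ₚ
                 constP K (F-basis j i) ⊗ monomial (setAt X k Y) j ⊕ constP K (F-basis j i) ⊗ monomial (setAt X k W) j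
    term j = ≈ₚ-trans (⊗-congʳ (constP K (F-basis j i)) (monomial-setAt-⊕ X k Y W j))
                      (⊗-distribˡ (constP K (F-basis j i)) (monomial (setAt X k Y) j) (monomial (setAt X k W) j))

  G-shift : ∀ (X : Fin m → Fin n → Poly K) i → G K F (λ k l → shift (X k l)) i ≈ₚ shift^ m (G K F X i)
  G-shift X i = ≈ₚ-trans (∑ₚ-cong term (allFuns m (allFin n))) (∑ₚ-shift^ m _ (allFuns m (allFin n)))
    where
    open ≈-Reasoning ≈ₚ-setoid
    term : ∀ j → constP K (F-basis j i) ⊗ monomial (λ k l → shift (X k l)) j ≈ₚ shift^ m (constP K (F-basis j i) ⊗ monomial X j)
    term j = begin
      a ⊗ monomial (λ k l → shift (X k l)) j
        ≈⟨ ⊗-congʳ a (∏ₚ-shift (λ k → X k (j k)) (allFin m)) ⟩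
      a ⊗ shift^ (length (allFin m)) (monomial X j)
        ≡⟨ ≡.cong (λ t → a ⊗ shift^ t (monomial X j)) (List.length-tabulate id) ⟩
      a ⊗ shift^ m (monomial X j)
        ≈⟨ ⊗-shift^ m a (monomial X j) ⟩
      shift^ m (a ⊗ monomial X j) ∎
      where
      a : Poly K
      a = constP K (F-basis j i)

  G-constant-term : Multilinear F → ∀ (X : Fin m → Fin n → Poly K) i →
                    coef (G K F X i) zero ≈ F (snoc (λ k l → coef (X k l) zero) (e K i))
  G-constant-term F-ml X i = begin
    coef (G K F X i) zero
      ≈⟨ coef-∑ₚ _ (allFuns m (allFin n)) zero ⟩
    ∑[ j ∈ allFuns m (allFin n) ] coef (constP K (F-basis j i) ⊗ monomial X j) zero
      ≈⟨ ∑-cong (λ j → trans (coef-⊗-zero (constP K (F-basis j i)) (monomial X j))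
                             (*-cong refl (coef-∏ₚ-zero (λ k → X k (j k)) (allFin m))))
                (allFuns m (allFin n)) ⟩
    ∑[ j ∈ allFuns m (allFin n) ] F-basis j i * (∏[ k ∈ allFin m ] coef (X k (j k)) zero)
      ≈⟨ expand m (Multilinear-snoc F-ml (e K i)) (λ k l → coef (X k l) zero) ⟨
    F (snoc (λ k l → coef (X k l) zero) (e K i)) ∎
    where open ≈-Reasoning setoid

module ZeroCounting {c ℓ} (K : CommutativeRing c ℓ) (FF : IsFiniteField K) {n m : ℕ}
                    (F : (Fin (suc m) → Vecn K n) → CommutativeRing.Carrier K) (F-ml : IsMultilinear K F) where

  open CommutativeRing K hiding (zero)
  open IsFiniteField FF using (_≟K_; elems; complete; unique)
  open Ringₚ ring using (+-cancelʳ)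
  open Polynomials K
  open MultilinearMaps K
  open BaseChange K F
  open Lists
  open Counting
  open Enumeration using (Funs; allFuns-isEnumeration; allFuns-unique)

  F-multilinear : Multilinear F
  F-multilinear = record { cong = IsMultilinear.cong F-ml ; linear = IsMultilinear.linear F-ml }

  Tuple : ℕ → Set c
  Tuple R = Fin m → Fin n → PolyLt K R

  Row : ℕ → Set c
  Row R = Fin n → PolyLt K R

  infix 4 _≋_
  _≋_ : ∀ {R} → Tuple R → Tuple R → Set ℓ
  x ≋ x′ = ∀ k l s → x k l s ≈ x′ k l s

  polys : ∀ {R} → Tuple R → Fin m → Fin n → Poly K
  polys x k l = toPoly K (x k l)

  Z : ∀ R → Tuple R → Set (c ⊔ ℓ)
  Z R = GZero K FF F R

  Z-resp : ∀ {R} {x x′ : Tuple R} → x ≋ x′ → Z R x → Z R x′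
  Z-resp x≋x′ Zx i =
    ≈ₚ[]⇒IsZeroP (≈ₚ-trans (≈ₚ-sym (G-cong (λ k l → toPoly-cong (x≋x′ k l)) i)) (IsZeroP⇒≈ₚ[] (Zx i)))

  setAt-≋ : ∀ {R} {x x′ : Tuple R} k → (∀ k′ → k′ ≢ k → ∀ l s → x k′ l s ≈ x′ k′ l s) →
            ∀ {y y′ : Row R} → (∀ l s → y l s ≈ y′ l s) → setAt x k y ≋ setAt x′ k y′
  setAt-≋ {x = x} {x′} k x≈x′ {y} {y′} =
    Tuples.setAt-pointwise {R = λ u v → ∀ l s → u l s ≈ v l s} {x = x} {x′} {y} {y′} k x≈x′

  Z-setAt-self : ∀ {R} k {x : Tuple R} → Z R x → Z R (setAt x k (x k))
  Z-setAt-self k {x} = Z-resp (λ k′ l s → reflexive (≡.cong (λ r → r l s) (≡.sym (Tuples.setAt-id x k k′))))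

  constantTerms : ∀ {R} → Tuple (suc R) → Fin m → Vecn K n
  constantTerms x k l = x k l zero

  Z⇒constantTerms∈S : ∀ {R} {x : Tuple (suc R)} → Z (suc R) x → InS K FF F (constantTerms x)
  Z⇒constantTerms∈S {x = x} Zx = All.universal (vanishes-on-basis⇒vanishes F-multilinear (constantTerms x) λ i →
    trans (sym (G-constant-term F-multilinear (polys x) i)) (coef-≈ (IsZeroP⇒≈ₚ[] (Zx i)) zero)) _

  InS-resp : ∀ {b b′ : Fin m → Vecn K n} → (∀ k l → b k l ≈ b′ k l) → InS K FF F b → InS K FF F b′
  InS-resp b≈b′ = All.map λ F[b,y]≈0 →
    trans (IsMultilinear.cong F-ml _ _ (snoc-cong (λ k l → sym (b≈b′ k l)) (λ l → refl))) F[b,y]≈0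

  infixl 6 _−ᵣ_
  _−ᵣ_ : ∀ {R} → Row R → Row R → Row R
  (u −ᵣ v) l s = u l s - v l s

  G-polys-setAt : ∀ {R} (x : Tuple R) k (u : Row R) i →
                  G K F (polys (setAt x k u)) i ≈ₚ G K F (setAt (polys x) k (λ l → toPoly K (u l))) i
  G-polys-setAt x k u i =
    G-cong (λ k′ l → ≈ₚ-reflexive (≡.cong (λ r → r l) (Tuples.setAt-∘ (λ r l → toPoly K (r l)) x k u k′))) i

  G-setAt-− : ∀ {R} (x : Tuple R) k (u v : Row R) i →
              G K F (polys (setAt x k u)) i ≈ₚ G K F (polys (setAt x k (u −ᵣ v))) i ⊕ G K F (polys (setAt x k v)) i
  G-setAt-− x k u v i = begin
    G K F (polys (setAt x k u)) i
      ≈⟨ G-polys-setAt x k u i ⟩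
    G K F (setAt (polys x) k (λ l → toPoly K (u l))) i
      ≈⟨ G-cong (Tuples.setAt-pointwise {R = λ p q → ∀ l → p l ≈ₚ q l} {x = polys x} {polys x} k
                                        (λ _ _ l → ≈ₚ-refl) split) i ⟩
    G K F (setAt (polys x) k (λ l → toPoly K ((u −ᵣ v) l) ⊕ toPoly K (v l))) i
      ≈⟨ G-setAt-⊕ (polys x) k _ _ i ⟩
    G K F (setAt (polys x) k (λ l → toPoly K ((u −ᵣ v) l))) i ⊕ G K F (setAt (polys x) k (λ l → toPoly K (v l))) i
      ≈⟨ ⊕-cong (≈ₚ-sym (G-polys-setAt x k (u −ᵣ v) i)) (≈ₚ-sym (G-polys-setAt x k v i)) ⟩
    G K F (polys (setAt x k (u −ᵣ v))) i ⊕ G K F (polys (setAt x k v)) i ∎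
    where
    open ≈-Reasoning ≈ₚ-setoid
    split : ∀ l → toPoly K (u l) ≈ₚ toPoly K ((u −ᵣ v) l) ⊕ toPoly K (v l)
    split l =
      ≈ₚ-trans (toPoly-cong (λ s → sym (minus-plus (u l s) (v l s)))) (≈ₚ-reflexive (toPoly-+ ((u −ᵣ v) l) (v l)))
      where
      minus-plus : ∀ a b → (a - b) + b ≈ a
      minus-plus a b = trans (+-assoc a (- b) b) (trans (+-cong refl (-‿inverseˡ b)) (+-identityʳ a))

  Z-setAt-− : ∀ {R} (x : Tuple R) k (u v : Row R) →
              Z R (setAt x k u) → Z R (setAt x k v) → Z R (setAt x k (u −ᵣ v))
  Z-setAt-− x k u v Zu Zv i = ≈ₚ[]⇒IsZeroP (begin
    G K F (polys (setAt x k (u −ᵣ v))) i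
      ≈⟨ ⊕-identityʳ _ ⟨
    G K F (polys (setAt x k (u −ᵣ v))) i ⊕ []
      ≈⟨ ⊕-cong ≈ₚ-refl (IsZeroP⇒≈ₚ[] (Zv i)) ⟨
    G K F (polys (setAt x k (u −ᵣ v))) i ⊕ G K F (polys (setAt x k v)) i
      ≈⟨ G-setAt-− x k u v i ⟨
    G K F (polys (setAt x k u)) i
      ≈⟨ IsZeroP⇒≈ₚ[] (Zu i) ⟩
    [] ∎)
    where open ≈-Reasoning ≈ₚ-setoid

  divT : ∀ {R} → Tuple (suc R) → Tuple R
  divT x k l s = x k l (suc s)

  Z-divT : ∀ {R} {x : Tuple (suc R)} → Z (suc R) x → (∀ k l → x k l zero ≈ 0#) → Z R (divT x)
  Z-divT {R} {x} Zx x₀≈0 i = IsZeroP-shift^ m (≈ₚ[]⇒IsZeroP (begin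
    shift^ m (G K F (polys (divT x)) i)
      ≈⟨ G-shift (polys (divT x)) i ⟨
    G K F (λ k l → shift (polys (divT x) k l)) i
      ≈⟨ G-cong {λ k l → shift (polys (divT x) k l)} {polys x}
                (λ k l → coefwise λ { zero → sym (x₀≈0 k l) ; (suc s) → refl }) i ⟩
    G K F (polys x) i
      ≈⟨ IsZeroP⇒≈ₚ[] (Zx i) ⟩
    [] ∎))
    where open ≈-Reasoning ≈ₚ-setoid

  divT-injective : ∀ {R} {x x′ : Tuple (suc R)} → (∀ k l → x k l zero ≈ x′ k l zero) → divT x ≋ divT x′ → x ≋ x′
  divT-injective x₀≈x′₀ divT≋ k l zero    = x₀≈x′₀ k l
  divT-injective x₀≈x′₀ divT≋ k l (suc s) = divT≋ k l s

  Rows : ℕ → Setoid c ℓ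
  Rows R = Funs (Funs setoid R) n

  Tuples : ℕ → Setoid c ℓ
  Tuples R = Funs (Rows R) m

  ConstantTerms : Setoid c ℓ
  ConstantTerms = Funs (Funs setoid n) m

  rows : ∀ R → List (Row R)
  rows R = allFuns n (allFuns R elems)

  tuples : ∀ R → List (Tuple R)
  tuples R = allFuns m (rows R)

  rows-isEnumeration : ∀ R → IsEnumeration (Rows R) (rows R)
  rows-isEnumeration R = allFuns-isEnumeration (Funs setoid R) (allFuns-isEnumeration setoid complete R) n

  tuples-isEnumeration : ∀ R → IsEnumeration (Tuples R) (tuples R)
  tuples-isEnumeration R = allFuns-isEnumeration (Rows R) (rows-isEnumeration R) m

  tuples-unique : ∀ R → Unique.Unique (Tuples R) (tuples R)
  tuples-unique R = allFuns-unique (Rows R) (allFuns-unique (Funs setoid R) (allFuns-unique setoid unique R) n) m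

  constantTerms-isEnumeration : IsEnumeration ConstantTerms (allFuns m (allVecs K FF n))
  constantTerms-isEnumeration = allFuns-isEnumeration (Funs setoid n) (allFuns-isEnumeration setoid complete n) m

  module Clearing {R : ℕ} where

    Pivot : Fin m → Tuple (suc R) → Row (suc R) → Set (c ⊔ ℓ)
    Pivot k x y = Z (suc R) (setAt x k y) × (∀ l → y l zero ≈ x k l zero)

    pivot? : ∀ k x → Decidable (Pivot k x)
    pivot? k x y = GZero? K FF F (suc R) (setAt x k y) ×-dec FinP.all? (λ l → y l zero ≟K x k l zero)

    -- Any y with Pivot k x y would do. The first one in a fixed enumeration depends only on
    -- the rows of x other than k and on the constant terms of row k, which makes φ k injective.
    pivot : Fin m → Tuple (suc R) → Row (suc R)
    pivot k x = fromMaybe (λ _ _ → 0#) (find (pivot? k x) (rows (suc R)))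

    Pivot-resp : ∀ k {x y y′} → (∀ l s → y l s ≈ y′ l s) → Pivot k x y → Pivot k x y′
    Pivot-resp k y≈y′ (Zy , y₀) = Z-resp (setAt-≋ k (λ _ _ l s → refl) y≈y′) Zy , λ l → trans (sym (y≈y′ l zero)) (y₀ l)

    pivot-spec : ∀ k {x} → Z (suc R) x → Pivot k x (pivot k x)
    pivot-spec k {x} Zx
      with find-just (pivot? k x) (Any.map (λ x[k]≈y → Pivot-resp k x[k]≈y (Z-setAt-self k Zx , λ l → refl))
                                            (rows-isEnumeration (suc R) (x k)))
    ... | y , found , pivot-y = ≡.subst (Pivot k x) (≡.cong (fromMaybe _) (≡.sym found)) pivot-y

    pivot-cong : ∀ k {x x′} → (∀ k′ → k′ ≢ k → ∀ l s → x k′ l s ≈ x′ k′ l s) → (∀ l → x k l zero ≈ x′ k l zero) →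
                 pivot k x ≡ pivot k x′
    pivot-cong k x≈x′ x₀≈x′₀ = ≡.cong (fromMaybe _) (find-≐ (pivot? k _) (pivot? k _)
      ( (λ (Zy , y₀) → Z-resp (setAt-≋ k x≈x′ (λ l s → refl)) Zy
                      , λ l → trans (y₀ l) (x₀≈x′₀ l))
      , (λ (Zy , y₀) → Z-resp (setAt-≋ k (λ k′ k′≢k l s → sym (x≈x′ k′ k′≢k l s)) (λ l s → refl)) Zy
                      , λ l → trans (y₀ l) (sym (x₀≈x′₀ l))))
      (rows (suc R)))

    φ : Fin m → Tuple (suc R) → Tuple (suc R)
    φ k x = setAt x k (x k −ᵣ pivot k x)

    Cleared : Fin m → Tuple (suc R) → Set ℓ
    Cleared k x = ∀ l → x k l zero ≈ 0#

    φ-Z : ∀ k {x} → Z (suc R) x → Z (suc R) (φ k x)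
    φ-Z k {x} Zx = Z-setAt-− x k (x k) (pivot k x) (Z-setAt-self k Zx) (proj₁ (pivot-spec k Zx))

    φ-clears : ∀ k {x} → Z (suc R) x → Cleared k (φ k x)
    φ-clears k {x} Zx l = begin
      φ k x k l zero
        ≡⟨ ≡.cong (λ r → r l zero) (Tuples.setAt-same x k (x k −ᵣ pivot k x)) ⟩
      x k l zero - pivot k x l zero
        ≈⟨ +-cong refl (-‿cong (proj₂ (pivot-spec k Zx) l)) ⟩
      x k l zero - x k l zero
        ≈⟨ -‿inverseʳ _ ⟩
      0# ∎
      where open ≈-Reasoning setoid

    φ-other : ∀ k {k′} x → k′ ≢ k → φ k x k′ ≡ x k′
    φ-other k x = Tuples.setAt-other x k (x k −ᵣ pivot k x)

    φ-keeps-cleared : ∀ k {k′ x} → Z (suc R) x → Cleared k′ x → Cleared k′ (φ k x)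
    φ-keeps-cleared k {k′} {x} Zx x-cleared = by-cases (k′ Fin.≟ k)
      where
      by-cases : Dec (k′ ≡ k) → Cleared k′ (φ k x)
      by-cases (yes ≡.refl) = φ-clears k Zx
      by-cases (no k′≢k)    = λ l → trans (reflexive (≡.cong (λ r → r l zero) (φ-other k x k′≢k))) (x-cleared l)

    φ-≋-other : ∀ k {x x′} → φ k x ≋ φ k x′ → ∀ k′ → k′ ≢ k → ∀ l s → x k′ l s ≈ x′ k′ l s
    φ-≋-other k {x} {x′} φx≋φx′ k′ k′≢k l s = begin
      x k′ l s      ≡⟨ ≡.cong (λ r → r l s) (φ-other k x k′≢k) ⟨
      φ k x k′ l s  ≈⟨ φx≋φx′ k′ l s ⟩
      φ k x′ k′ l s ≡⟨ ≡.cong (λ r → r l s) (φ-other k x′ k′≢k) ⟩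
      x′ k′ l s     ∎
      where open ≈-Reasoning setoid

    φ-injective : ∀ k {x x′} → (∀ l → x k l zero ≈ x′ k l zero) → φ k x ≋ φ k x′ → x ≋ x′
    φ-injective k {x} {x′} x₀≈x′₀ φx≋φx′ k′ with k′ Fin.≟ k
    ... | no k′≢k    = φ-≋-other k φx≋φx′ k′ k′≢k
    ... | yes ≡.refl = λ l s → +-cancelʳ (- pivot k x l s) _ _ (begin
      x k l s - pivot k x l s
        ≡⟨ ≡.cong (λ r → r l s) (Tuples.setAt-same x k (x k −ᵣ pivot k x)) ⟨
      φ k x k l s
        ≈⟨ φx≋φx′ k l s ⟩
      φ k x′ k l s
        ≡⟨ ≡.cong (λ r → r l s) (Tuples.setAt-same x′ k (x′ k −ᵣ pivot k x′)) ⟩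
      x′ k l s - pivot k x′ l s
        ≡⟨ ≡.cong (λ r → x′ k l s - r l s) (pivot-cong k (φ-≋-other k φx≋φx′) x₀≈x′₀) ⟨
      x′ k l s - pivot k x l s ∎)
      where open ≈-Reasoning setoid

    Φ : List (Fin m) → Tuple (suc R) → Tuple (suc R)
    Φ []       x = x
    Φ (k ∷ ks) x = Φ ks (φ k x)

    Φ-Z : ∀ ks {x} → Z (suc R) x → Z (suc R) (Φ ks x)
    Φ-Z []       Zx = Zx
    Φ-Z (k ∷ ks) Zx = Φ-Z ks (φ-Z k Zx)

    Φ-clears : ∀ ks {x} → Z (suc R) x → ∀ k → k ∈ ks ⊎ Cleared k x → Cleared k (Φ ks x)
    Φ-clears []        Zx k (inj₂ x-cleared)         = x-cleared
    Φ-clears (k₀ ∷ ks) Zx k (inj₁ (here ≡.refl))     = Φ-clears ks (φ-Z k₀ Zx) k (inj₂ (φ-clears k₀ Zx))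
    Φ-clears (k₀ ∷ ks) Zx k (inj₁ (there k∈ks))      = Φ-clears ks (φ-Z k₀ Zx) k (inj₁ k∈ks)
    Φ-clears (k₀ ∷ ks) {x} Zx k (inj₂ x-cleared)     =
      Φ-clears ks (φ-Z k₀ Zx) k (inj₂ (φ-keeps-cleared k₀ {k} {x} Zx x-cleared))

    Φ-injective : ∀ ks {x x′} → Z (suc R) x → Z (suc R) x′ → (∀ k l → x k l zero ≈ x′ k l zero) →
                  Φ ks x ≋ Φ ks x′ → x ≋ x′
    Φ-injective []       Zx Zx′ x₀≈x′₀ Φx≋Φx′ = Φx≋Φx′
    Φ-injective (k ∷ ks) {x} {x′} Zx Zx′ x₀≈x′₀ Φx≋Φx′ =
      φ-injective k (x₀≈x′₀ k) (Φ-injective ks (φ-Z k Zx) (φ-Z k Zx′) (λ k′ → by-cases (k′ Fin.≟ k)) Φx≋Φx′)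
      where
      by-cases : ∀ {k′} → Dec (k′ ≡ k) → ∀ l → φ k x k′ l zero ≈ φ k x′ k′ l zero
      by-cases (yes ≡.refl) l = trans (φ-clears k Zx l) (sym (φ-clears k Zx′ l))
      by-cases {k′} (no k′≢k) l = begin
        φ k x k′ l zero  ≡⟨ ≡.cong (λ r → r l zero) (φ-other k x k′≢k) ⟩
        x k′ l zero      ≈⟨ x₀≈x′₀ k′ l ⟩
        x′ k′ l zero     ≡⟨ ≡.cong (λ r → r l zero) (φ-other k x′ k′≢k) ⟨
        φ k x′ k′ l zero ∎
        where open ≈-Reasoning setoid

    embed : Tuple (suc R) → (Fin m → Vecn K n) × Tuple R
    embed x = constantTerms x , divT (Φ (allFin m) x)

    Φ-clears-all : ∀ {x} → Z (suc R) x → ∀ k → Cleared k (Φ (allFin m) x)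
    Φ-clears-all Zx k = Φ-clears (allFin m) Zx k (inj₁ (∈-allFin k))

    embed-injective : ∀ {x x′} → Z (suc R) x → Z (suc R) x′ →
                      Setoid._≈_ (ConstantTerms ×ₛ Tuples R) (embed x) (embed x′) → x ≋ x′
    embed-injective {x} {x′} Zx Zx′ (x₀≈x′₀ , divT≋) = Φ-injective (allFin m) Zx Zx′ x₀≈x′₀
      (divT-injective {x = Φ (allFin m) x} {Φ (allFin m) x′}
                      (λ k l → trans (Φ-clears-all Zx k l) (sym (Φ-clears-all Zx′ k l))) divT≋)

    S-points : List (Fin m → Vecn K n)
    S-points = filter (InS? K FF F) (allFuns m (allVecs K FF n))

    Z-points : List (Tuple R)
    Z-points = filter (GZero? K FF F R) (tuples R)

    embed-into : ∀ {x} → Z (suc R) x →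
                 Membership._∈_ (ConstantTerms ×ₛ Tuples R) (embed x) (cartesianProduct S-points Z-points)
    embed-into {x} Zx = Membershipₚ.∈-cartesianProduct⁺ ConstantTerms (Tuples R)
      (Membershipₚ.∈-filter⁺ ConstantTerms (InS? K FF F) InS-resp
        (constantTerms-isEnumeration (constantTerms x)) (Z⇒constantTerms∈S {x = x} Zx))
      (Membershipₚ.∈-filter⁺ (Tuples R) (GZero? K FF F R) Z-resp
        (tuples-isEnumeration R (divT (Φ (allFin m) x)))
        (Z-divT {x = Φ (allFin m) x} (Φ-Z (allFin m) Zx) (Φ-clears-all Zx)))

  N-bound : ∀ R → N K FF F (suc R) ≤ cardS K FF F ℕ.* N K FF F R
  N-bound R = begin
    N K FF F (suc R)
      ≤⟨ countL-≤-injection (Tuples (suc R)) (ConstantTerms ×ₛ Tuples R) (GZero? K FF F (suc R))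
                                                 embed (tuples-unique (suc R)) embed-injective embed-into ⟩
    length (cartesianProduct S-points Z-points)
      ≡⟨ length-cartesianProduct S-points Z-points ⟩
    cardS K FF F ℕ.* N K FF F R ∎
    where
    open ℕₚ.≤-Reasoning
    open Clearing {R}

lemma5p3 : ∀ {c ℓ} (K : CommutativeRing c ℓ) (FF : IsFiniteField K)
           (n m : ℕ) (F : (Fin (suc m) → Vecn K n) → CommutativeRing.Carrier K) →
           IsMultilinear K F →
           (R : ℕ) → 1 < R →
           N K FF F R ≤ cardS K FF F ℕ.* N K FF F (R ∸ 1)
lemma5p3 K FF n m F F-ml (suc (suc R)) (s≤s (s≤s z≤n)) = ZeroCounting.N-bound K FF F F-ml (suc R)
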